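{- Let $\mathcal{D}=(\mathcal{P},\mathcal{B},\mathcal{I})$ be a non-trivial $G$-locally primitive $2$-$(v,k,\lambda)$ design with $G\le\mathrm{Aut}(\mathcal{D})$, such that $G^{\mathcal{P}}$ is a primitive affine group and $G^{\mathcal{B}}$ is not quasiprimitive. Let $N$ be the socle of $G$ (the translation subgroup, regular on $\mathcal{P}$). Then every $N$-orbit on $\mathcal{B}$ has size $\frac{v}{k}=\frac{b}{r}$.
   Context: A $2$-$(v,k,\lambda)$ design has $v\ge2$ points, $b$ blocks, each block incident with $k$ points, any two distinct points incident with exactly $\lambda\ge1$ blocks, and each point on $r$ blocks; non-trivial means $k<v$. $\mathcal{D}(\alpha)$ = blocks on a point $\alpha$; $\mathcal{D}(\beta)$ = points on a block $\beta$. $G$-locally primitive: $G_\alpha$ primitive on $\mathcal{D}(\alpha)$ and $G_\beta$ primitive on $\mathcal{D}(\beta)$ for all points and blocks. Quasiprimitive: transitive with every nontrivial normal subgroup transitive. A primitive affine group is a primitive $G\le\mathrm{AGL}(m,p)$ containing the translation group $\mathbb{Z}_p^m$, which is then its socle. -}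

module Defs where

open import Data.Nat using (ℕ; zero; suc; _+_; _*_; _≤_; _<_)
open import Data.Nat.DivMod using (_mod_)
open import Data.Nat.Primality using (Prime)
open import Data.Bool using (Bool; true; false; if_then_else_; _∧_)
open import Data.Fin using (Fin; toℕ)
import Data.Fin as F
open import Data.Fin.Permutation using (Permutation; Permutation′; _⟨$⟩ʳ_; _∘ₚ_; flip) renaming (id to idₚ)
open import Data.Vec using (Vec; zipWith; map; sum)
open import Data.Product using (Σ; ∃; _×_; _,_)
open import Data.Sum using (_⊎_)
open import Function.Bundles using (_↔_; Inverse)
open import Relation.Binary.PropositionalEquality using (_≡_; _≢_)
open import Relation.Nullary using (¬_)

count : ∀ {n} → (Fin n → Bool) → ℕ
count {zero}  f = 0
count {suc n} f = (if f F.zero then 1 else 0) + count (λ i → f (F.suc i))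

record Is2Design (v b k lam : ℕ) (I : Fin v → Fin b → Bool) : Set where
  field
    two≤v     : 2 ≤ v
    blockSize : ∀ (β : Fin b) → count (λ α → I α β) ≡ k
    balanced  : ∀ (α α′ : Fin v) → α ≢ α′ → count (λ β → I α β ∧ I α′ β) ≡ lam
    lam≥1     : 1 ≤ lam

repl : ∀ {v b} → (Fin v → Fin b → Bool) → Fin v → ℕ
repl I α = count (λ β → I α β)

-- Automorphisms: a permutation of points together with a permutation of
-- blocks.  A group G of automorphisms is a predicate on such pairs.

record Auto (v b : ℕ) : Set where
  constructor auto
  field
    pt : Permutation′ v
    bl : Permutation′ b
open Auto public

idA : ∀ {v b} → Auto v b
idA = auto idₚ idₚ

_∘A_ : ∀ {v b} → Auto v b → Auto v b → Auto v b
g ∘A h = auto (pt g ∘ₚ pt h) (bl g ∘ₚ bl h)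

invA : ∀ {v b} → Auto v b → Auto v b
invA g = auto (flip (pt g)) (flip (bl g))

PreservesInc : ∀ {v b} → (Fin v → Fin b → Bool) → Auto v b → Set
PreservesInc I g = ∀ α β → I (pt g ⟨$⟩ʳ α) (bl g ⟨$⟩ʳ β) ≡ I α β

record IsAutGroup {v b} (I : Fin v → Fin b → Bool) (G : Auto v b → Set) : Set where
  field
    aut    : ∀ g → G g → PreservesInc I g
    hasId  : G idA
    closed : ∀ g h → G g → G h → G (g ∘A h)
    inv    : ∀ g → G g → G (invA g)

record IsEquivOn {n} (S : Fin n → Bool) (R : Fin n → Fin n → Bool) : Set where
  field
    reflOn  : ∀ x → S x ≡ true → R x x ≡ true
    symOn   : ∀ x y → S x ≡ true → S y ≡ true → R x y ≡ true → R y x ≡ true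
    transOn : ∀ x y z → S x ≡ true → S y ≡ true → S z ≡ true →
              R x y ≡ true → R y z ≡ true → R x z ≡ true

TransitiveOn : ∀ {A : Set} {n} → (A → Set) → (A → Fin n → Fin n) → (Fin n → Bool) → Set
TransitiveOn H act S =
  ∀ x y → S x ≡ true → S y ≡ true → ∃ λ h → H h × act h x ≡ y

record PrimitiveOn {A : Set} {n} (H : A → Set) (act : A → Fin n → Fin n)
                   (S : Fin n → Bool) : Set₁ where
  field
    transitive : TransitiveOn H act S
    noBlocks   : ∀ (R : Fin n → Fin n → Bool) → IsEquivOn S R →
      (∀ h → H h → ∀ x y → S x ≡ true → S y ≡ true → R (act h x) (act h y) ≡ R x y) →
      (∀ x y → S x ≡ true → S y ≡ true → R x y ≡ true → x ≡ y) ⊎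
      (∀ x y → S x ≡ true → S y ≡ true → R x y ≡ true)

ptAct : ∀ {v b} → Auto v b → Fin v → Fin v
ptAct g α = pt g ⟨$⟩ʳ α

blAct : ∀ {v b} → Auto v b → Fin b → Fin b
blAct g β = bl g ⟨$⟩ʳ β

record LocallyPrimitive {v b} (I : Fin v → Fin b → Bool) (G : Auto v b → Set) : Set₁ where
  field
    atPoint : ∀ (α : Fin v) →
      PrimitiveOn (λ g → G g × ptAct g α ≡ α) blAct (λ β → I α β)
    atBlock : ∀ (β : Fin b) →
      PrimitiveOn (λ g → G g × blAct g β ≡ β) ptAct (λ α → I α β)

InGB : ∀ {v b} → (Auto v b → Set) → Permutation′ b → Set
InGB G τ = ∃ λ g → G g × (∀ β → bl g ⟨$⟩ʳ β ≡ τ ⟨$⟩ʳ β)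

record IsNontrivNormalSubgroupOfGB {v b} (G : Auto v b → Set)
                                   (M : Permutation′ b → Set) : Set where
  field
    sub        : ∀ τ → M τ → InGB G τ
    hasId      : M idₚ
    closed     : ∀ σ τ → M σ → M τ → M (σ ∘ₚ τ)
    inv        : ∀ τ → M τ → M (flip τ)
    normal     : ∀ g τ → G g → M τ → M (flip (bl g) ∘ₚ (τ ∘ₚ bl g))
    nontrivial : ∃ λ τ → M τ × ∃ λ β → τ ⟨$⟩ʳ β ≢ β

record QuasiprimitiveOnBlocks {v b} (G : Auto v b → Set) : Set₁ where
  field
    transitive : TransitiveOn G blAct (λ _ → true)
    normalTransitive : ∀ (M : Permutation′ b → Set) → IsNontrivNormalSubgroupOfGB G M →
      TransitiveOn M (λ τ β → τ ⟨$⟩ʳ β) (λ _ → true)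

-- Affine structure: vectors over Z_p with p = suc q, identified with points
-- via a bijection φ : Fin v ↔ Vec (Fin p) m.

module _ {q : ℕ} where
  _+ₚ_ : Fin (suc q) → Fin (suc q) → Fin (suc q)
  a +ₚ c = (toℕ a + toℕ c) mod (suc q)

  vadd : ∀ {m} → Vec (Fin (suc q)) m → Vec (Fin (suc q)) m → Vec (Fin (suc q)) m
  vadd = zipWith _+ₚ_

  dot : ∀ {m} → Vec (Fin (suc q)) m → Vec (Fin (suc q)) m → Fin (suc q)
  dot u w = sum (zipWith (λ a c → toℕ a * toℕ c) u w) mod (suc q)

  matVec : ∀ {m} → Vec (Vec (Fin (suc q)) m) m → Vec (Fin (suc q)) m → Vec (Fin (suc q)) m
  matVec A u = map (λ row → dot row u) A

module _ {v b q m : ℕ} (φ : Fin v ↔ Vec (Fin (suc q)) m) where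
  private
    φ→ : Fin v → Vec (Fin (suc q)) m
    φ→ = Inverse.to φ

  -- g acts on points (via φ) as x ↦ A x + c with A ∈ GL(m, p)
  IsAffineVia : Auto v b → Set
  IsAffineVia g = ∃ λ (A : Vec (Vec (Fin (suc q)) m) m) → ∃ λ (c : Vec (Fin (suc q)) m) →
    (∃ λ (A′ : Vec (Vec (Fin (suc q)) m) m) → ∀ u → matVec A′ (matVec A u) ≡ u) ×
    (∀ α → φ→ (pt g ⟨$⟩ʳ α) ≡ vadd (matVec A (φ→ α)) c)

  IsTranslationVia : Auto v b → Set
  IsTranslationVia g = ∃ λ (c : Vec (Fin (suc q)) m) →
    ∀ α → φ→ (pt g ⟨$⟩ʳ α) ≡ vadd (φ→ α) c

  record PrimitiveAffineVia (G : Auto v b → Set) : Set₁ where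
    field
      prime        : Prime (suc q)
      affine       : ∀ g → G g → IsAffineVia g
      translations : ∀ (c : Vec (Fin (suc q)) m) → ∃ λ g → G g ×
                       (∀ α → φ→ (pt g ⟨$⟩ʳ α) ≡ vadd (φ→ α) c)
      isPrimitive  : PrimitiveOn G ptAct (λ _ → true)

  Socle : (Auto v b → Set) → Auto v b → Set
  Socle G g = G g × IsTranslationVia g

InjectiveFn : ∀ {s b} → (Fin s → Fin b) → Set
InjectiveFn f = ∀ i j → f i ≡ f j → i ≡ j

OrbitSize : ∀ {v b} → (Auto v b → Set) → Fin b → ℕ → Set
OrbitSize {b = b} H β s = Σ (Fin s → Fin b) λ f →
  InjectiveFn f ×
  (∀ i → ∃ λ g → H g × bl g ⟨$⟩ʳ β ≡ f i) ×
  (∀ β′ → (∃ λ g → H g × bl g ⟨$⟩ʳ β ≡ β′) → ∃ λ i → f i ≡ β′)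

{-# OPTIONS --safe #-}
module Submission where

-- Blocks are determined by their points (G_α is
-- primitive on D(α) and the design is non-trivial), so an element of G acts on blocks as its
-- action on points dictates; in particular h t_c h⁻¹ = t_{Ac} when h acts as x ↦ Ax + s.  Hence
-- the N-orbit relation on blocks is G-invariant, and primitivity of G_α on D(α) makes it trivial
-- or universal there.  If it is universal, N is transitive on blocks and G^B is quasiprimitive:
-- a nontrivial normal subgroup M of G^B contains a nonzero translation (an element of M, or its
-- commutator with a translation), and the G-submodule of ℤₚ^m spanned by it is everything,
-- because its cosets form a G-invariant partition of the points.  So every N-orbit meets every
-- D(α) in exactly one block, and double counting gives |orbit|·k = v and |orbit|·r = b.

open import Defs
open import Data.Nat using (ℕ; zero; suc; _+_; _*_; _∸_; _≤_; _<_; s≤s; z<s; >-nonZero)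
open import Data.Nat.Properties as ℕ using (+-0-commutativeMonoid)
open import Data.Nat.DivMod using (_%_; _mod_; m%n<n; m<n⇒m%n≡m; n%n≡0; m%n%n≡m%n; %-distribˡ-+; %-distribˡ-*)
open import Data.Bool using (Bool; true; false; if_then_else_; _∧_)
open import Data.Bool.Properties as Bool using (¬-not; not-¬)
open import Data.Fin as Fin using (Fin; zero; suc; toℕ)
open import Data.Fin.Properties using (all?; any?; ¬∀⟶∃¬; toℕ-injective; toℕ-fromℕ<; toℕ<n; suc-injective; 0≢1+n)
import Data.Fin.Permutation as Perm
open Perm using (Permutation′; _⟨$⟩ʳ_; _⟨$⟩ˡ_; _∘ₚ_; flip)
open import Data.Vec using (Vec; []; _∷_; zipWith; replicate; map)
open import Data.Vec.Properties using (≡-dec; zipWith-assoc; zipWith-comm; zipWith-identityˡ; zipWith-identityʳ; zipWith-inverseˡ; zipWith-inverseʳ)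
open import Data.Product using (Σ; ∃; ∃₂; _×_; _,_; proj₁; proj₂; map₂)
open import Data.Sum as Sum using (_⊎_; inj₁; inj₂)
open import Data.Empty using (⊥-elim)
open import Function.Base using (_∘_)
open import Function.Bundles using (_↔_; _⇔_; Inverse; Equivalence; mk⇔)
open import Level using (0ℓ)
open import Algebra.Bundles using (AbelianGroup)
open import Algebra.Structures using (IsAbelianGroup)
open import Relation.Binary.Core using (Rel)
open import Relation.Binary.Definitions using (Decidable)
open import Relation.Binary.Structures using (IsEquivalence)
open import Relation.Binary.PropositionalEquality using (_≡_; _≢_; refl; sym; trans; cong; cong₂; subst; subst₂; isEquivalence; module ≡-Reasoning)
open import Relation.Nullary using (¬_; Dec; yes; no; does; _because_)
open import Relation.Nullary.Reflects using (invert)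
open import Relation.Nullary.Decidable using (dec-true; does-⇔; map′)
open import Relation.Nullary.Negation using (¬¬-map)
open import Relation.Nullary.Decidable.Core using (¬¬-excluded-middle)

open import Algebra.Properties.CommutativeMonoid.Sum +-0-commutativeMonoid using (sum-syntax; sum-cong-≗; ∑-comm)

-- Finite sets and counting

distinct-pair : ∀ {n} → 2 ≤ n → ∃₂ λ (i j : Fin n) → i ≢ j
distinct-pair (s≤s (s≤s _)) = zero , suc zero , λ ()

∧-≡-true : ∀ {x y} → x ∧ y ≡ true → x ≡ true × y ≡ true
∧-≡-true {true} {true} _ = refl , refl

count≡∑ : ∀ {n} (f : Fin n → Bool) → count f ≡ ∑[ i < n ] (if f i then 1 else 0)
count≡∑ {zero}  f = refl
count≡∑ {suc n} f = cong ((if f zero then 1 else 0) +_) (count≡∑ (f ∘ suc))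

count*c≡∑ : ∀ {n} (f : Fin n → Bool) c → count f * c ≡ ∑[ i < n ] (if f i then c else 0)
count*c≡∑ {zero}  f c = refl
count*c≡∑ {suc n} f c with f zero
... | true  = cong (c +_) (count*c≡∑ (f ∘ suc) c)
... | false = count*c≡∑ (f ∘ suc) c

∑-1 : ∀ n → ∑[ i < n ] 1 ≡ n
∑-1 zero    = refl
∑-1 (suc n) = cong suc (∑-1 n)

count-all-false : ∀ {n} (f : Fin n → Bool) → (∀ i → f i ≡ false) → count f ≡ 0
count-all-false {zero}  f _ = refl
count-all-false {suc n} f none rewrite none zero = count-all-false (f ∘ suc) (none ∘ suc)

count≡1 : ∀ {n} (f : Fin n → Bool) {a} → f a ≡ true → (∀ i → f i ≡ true → i ≡ a) → count f ≡ 1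
count≡1 {suc n} f {zero} fa unique rewrite fa =
  cong suc (count-all-false (f ∘ suc) λ i → ¬-not λ fi → 0≢1+n (sym (unique (suc i) fi)))
count≡1 {suc n} f {suc a} fa unique with f zero in f0
... | true  with () ← unique zero f0
... | false = count≡1 (f ∘ suc) fa (λ i fi → suc-injective (unique (suc i) fi))

0<count⇒∃true : ∀ {n} (f : Fin n → Bool) → 0 < count f → ∃ λ i → f i ≡ true
0<count⇒∃true {suc n} f pos with f zero in f0
... | true  = zero , f0
... | false with i , fi ← 0<count⇒∃true (f ∘ suc) pos = suc i , fi

true⇒0<count : ∀ {n} (f : Fin n → Bool) {i} → f i ≡ true → 0 < count f
true⇒0<count {suc n} f {zero} fi rewrite fi = z<s
true⇒0<count {suc n} f {suc i} fi with f zero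
... | true  = z<s
... | false = true⇒0<count (f ∘ suc) fi

count<n⇒∃false : ∀ {n} (f : Fin n → Bool) → count f < n → ∃ λ i → f i ≡ false
count<n⇒∃false {suc n} f lt with f zero in f0
... | false = zero , f0
... | true  with i , fi ← count<n⇒∃false (f ∘ suc) (ℕ.≤-pred lt) = suc i , fi

double-count : ∀ {n m c} (f : Fin n → Bool) (R : Fin n → Fin m → Bool) →
               (∀ i → f i ≡ true → count (R i) ≡ c) →
               (∀ j → count (λ i → f i ∧ R i j) ≡ 1) →
               count f * c ≡ m
double-count {n} {m} {c} f R rows columns = begin
  count f * c                                        ≡⟨ count*c≡∑ f c ⟩
  ∑[ i < n ] (if f i then c else 0)                  ≡⟨ sum-cong-≗ row ⟩
  ∑[ i < n ] count (λ j → f i ∧ R i j)               ≡⟨ sum-cong-≗ (λ i → count≡∑ (λ j → f i ∧ R i j)) ⟩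
  ∑[ i < n ] ∑[ j < m ] [ f i ∧ R i j ]              ≡⟨ ∑-comm (λ i j → [ f i ∧ R i j ]) ⟩
  ∑[ j < m ] ∑[ i < n ] [ f i ∧ R i j ]              ≡⟨ sum-cong-≗ (λ j → trans (sym (count≡∑ (λ i → f i ∧ R i j))) (columns j)) ⟩
  ∑[ j < m ] 1                                       ≡⟨ ∑-1 m ⟩
  m                                                  ∎
  where
  open ≡-Reasoning
  [_] : Bool → ℕ
  [ x ] = if x then 1 else 0
  row : ∀ i → (if f i then c else 0) ≡ count (λ j → f i ∧ R i j)
  row i with f i in fi
  ... | true  = sym (rows i fi)
  ... | false = sym (count-all-false (λ j → false ∧ R i j) λ _ → refl)

enumerate : ∀ {n} (f : Fin n → Bool) → Fin (count f) → Fin n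
enumerate {suc n} f i with f zero
enumerate {suc n} f zero    | true  = zero
enumerate {suc n} f (suc i) | true  = suc (enumerate (f ∘ suc) i)
enumerate {suc n} f i       | false = suc (enumerate (f ∘ suc) i)

enumerate-true : ∀ {n} (f : Fin n → Bool) i → f (enumerate f i) ≡ true
enumerate-true {suc n} f i with f zero in f0
enumerate-true {suc n} f zero    | true  = f0
enumerate-true {suc n} f (suc i) | true  = enumerate-true (f ∘ suc) i
enumerate-true {suc n} f i       | false = enumerate-true (f ∘ suc) i

enumerate-injective : ∀ {n} (f : Fin n → Bool) i j → enumerate f i ≡ enumerate f j → i ≡ j
enumerate-injective {suc n} f i j eq with f zero
enumerate-injective {suc n} f zero    zero    eq | true  = refl
enumerate-injective {suc n} f (suc i) (suc j) eq | true  = cong suc (enumerate-injective (f ∘ suc) i j (suc-injective eq))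
enumerate-injective {suc n} f i       j       eq | false = enumerate-injective (f ∘ suc) i j (suc-injective eq)

enumerate-surjective : ∀ {n} (f : Fin n → Bool) {x} → f x ≡ true → ∃ λ i → enumerate f i ≡ x
enumerate-surjective {suc n} f {x} fx with f zero in f0
enumerate-surjective {suc n} f {zero}  fx | true  = zero , refl
enumerate-surjective {suc n} f {suc x} fx | true
  with i , e ← enumerate-surjective (f ∘ suc) fx = suc i , cong suc e
enumerate-surjective {suc n} f {zero}  fx | false with () ← trans (sym fx) f0
enumerate-surjective {suc n} f {suc x} fx | false = map₂ (cong suc) (enumerate-surjective (f ∘ suc) fx)

-- Invariant relations under a primitive action

does≡true⇒ : ∀ {p} {P : Set p} (P? : Dec P) → does P? ≡ true → P
does≡true⇒ (true because [p]) _ = invert [p]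

TrivialOn UniversalOn : ∀ {n} → (Fin n → Bool) → Rel (Fin n) 0ℓ → Set
TrivialOn   S R = ∀ x y → S x ≡ true → S y ≡ true → R x y → x ≡ y
UniversalOn S R = ∀ x y → S x ≡ true → S y ≡ true → R x y

module _ {A : Set} {n} {H : A → Set} {act : A → Fin n → Fin n} {S : Fin n → Bool}
         (prim : PrimitiveOn H act S)
         {R : Rel (Fin n) 0ℓ} (R? : Decidable R) (R-equivalence : IsEquivalence R)
         (R-invariant : ∀ {h} → H h → ∀ {x y} → R (act h x) (act h y) ⇔ R x y) where

  private
    module R = IsEquivalence R-equivalence

    Rᵇ : Fin n → Fin n → Bool
    Rᵇ x y = does (R? x y)

    Rᵇ-equivalence : IsEquivOn S Rᵇ
    Rᵇ-equivalence = record
      { reflOn  = λ x _ → dec-true (R? x x) R.refl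
      ; symOn   = λ x y _ _ r → dec-true (R? y x) (R.sym (does≡true⇒ (R? x y) r))
      ; transOn = λ x y z _ _ _ r r′ → dec-true (R? x z) (R.trans (does≡true⇒ (R? x y) r) (does≡true⇒ (R? y z) r′))
      }

  primitive⇒trivial⊎universal : TrivialOn S R ⊎ UniversalOn S R
  primitive⇒trivial⊎universal =
    Sum.map (λ trivial x y Sx Sy r → trivial x y Sx Sy (dec-true (R? x y) r))
            (λ universal x y Sx Sy → does≡true⇒ (R? x y) (universal x y Sx Sy))
            (PrimitiveOn.noBlocks prim Rᵇ Rᵇ-equivalence
              λ h Hh x y _ _ → does-⇔ (R-invariant Hh) (R? (act h x) (act h y)) (R? x y))

¬¬-∀ : ∀ {n p} {P : Fin n → Set p} → (∀ i → ¬ ¬ P i) → ¬ ¬ (∀ i → P i)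
¬¬-∀ {zero}  _   k = k λ ()
¬¬-∀ {suc n} ¬¬P k = ¬¬P zero λ p₀ → ¬¬-∀ (¬¬P ∘ suc) λ pₛ → k λ where
  zero    → p₀
  (suc i) → pₛ i

-- The group ℤₚ and its powers

zipWith-isAbelianGroup : ∀ {A : Set} {_∙_ : A → A → A} {ε : A} {_⁻¹ : A → A} {n} →
                         IsAbelianGroup _≡_ _∙_ ε _⁻¹ →
                         IsAbelianGroup _≡_ (zipWith {n = n} _∙_) (replicate n ε) (map _⁻¹)
zipWith-isAbelianGroup {_∙_ = _∙_} G = record
  { isGroup = record
    { isMonoid = record
      { isSemigroup = record
        { isMagma = record { isEquivalence = isEquivalence ; ∙-cong = cong₂ (zipWith _∙_) }
        ; assoc   = zipWith-assoc G.assoc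
        }
      ; identity = zipWith-identityˡ G.identityˡ , zipWith-identityʳ G.identityʳ
      }
    ; inverse = zipWith-inverseˡ G.inverseˡ , zipWith-inverseʳ G.inverseʳ
    ; ⁻¹-cong = cong (map _)
    }
  ; comm = zipWith-comm G.comm
  }
  where module G = IsAbelianGroup G

module ℤₚ (q : ℕ) where

  private
    p : ℕ
    p = suc q

  [_] : ℕ → Fin p
  [ n ] = n mod p

  toℕ-[] : ∀ n → toℕ [ n ] ≡ n % p
  toℕ-[] n = toℕ-fromℕ< (m%n<n n p)

  []-toℕ : ∀ a → [ toℕ a ] ≡ a
  []-toℕ a = toℕ-injective (trans (toℕ-[] (toℕ a)) (m<n⇒m%n≡m (toℕ<n a)))

  []-+ : ∀ m n → [ m + n ] ≡ [ m ] +ₚ [ n ]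
  []-+ m n = toℕ-injective (begin
    toℕ [ m + n ]                  ≡⟨ toℕ-[] (m + n) ⟩
    (m + n) % p                    ≡⟨ %-distribˡ-+ m n p ⟩
    (m % p + n % p) % p            ≡⟨ cong₂ (λ x y → (x + y) % p) (toℕ-[] m) (toℕ-[] n) ⟨
    (toℕ [ m ] + toℕ [ n ]) % p    ≡⟨ toℕ-[] (toℕ [ m ] + toℕ [ n ]) ⟨
    toℕ ([ m ] +ₚ [ n ])           ∎)
    where open ≡-Reasoning

  []-*-toℕ : ∀ m n → [ m * toℕ [ n ] ] ≡ [ m * n ]
  []-*-toℕ m n = toℕ-injective (begin
    toℕ [ m * toℕ [ n ] ]          ≡⟨ toℕ-[] (m * toℕ [ n ]) ⟩
    (m * toℕ [ n ]) % p            ≡⟨ cong (λ x → (m * x) % p) (toℕ-[] n) ⟩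
    (m * (n % p)) % p              ≡⟨ %-distribˡ-* m (n % p) p ⟩
    (m % p * (n % p % p)) % p      ≡⟨ cong (λ x → (m % p * x) % p) (m%n%n≡m%n n p) ⟩
    (m % p * (n % p)) % p          ≡⟨ %-distribˡ-* m n p ⟨
    (m * n) % p                    ≡⟨ toℕ-[] (m * n) ⟨
    toℕ [ m * n ]                  ∎)
    where open ≡-Reasoning

  infix 30 -ₚ_
  -ₚ_ : Fin p → Fin p
  -ₚ a = [ p ∸ toℕ a ]

  +ₚ-isAbelianGroup : IsAbelianGroup _≡_ _+ₚ_ zero -ₚ_
  +ₚ-isAbelianGroup = record
    { isGroup = record
      { isMonoid = record
        { isSemigroup = record
          { isMagma = record { isEquivalence = isEquivalence ; ∙-cong = cong₂ _+ₚ_ }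
          ; assoc   = assoc
          }
        ; identity = []-toℕ , identityʳ
        }
      ; inverse = (λ a → trans (comm (-ₚ a) a) (inverseʳ a)) , inverseʳ
      ; ⁻¹-cong = cong -ₚ_
      }
    ; comm = comm
    }
    where
    open ≡-Reasoning

    comm : ∀ a c → a +ₚ c ≡ c +ₚ a
    comm a c = cong [_] (ℕ.+-comm (toℕ a) (toℕ c))

    identityʳ : ∀ a → a +ₚ zero ≡ a
    identityʳ a = trans (cong [_] (ℕ.+-identityʳ (toℕ a))) ([]-toℕ a)

    assoc : ∀ a c d → (a +ₚ c) +ₚ d ≡ a +ₚ (c +ₚ d)
    assoc a c d = begin
      [ toℕ a + toℕ c ] +ₚ d                  ≡⟨ cong ([ toℕ a + toℕ c ] +ₚ_) ([]-toℕ d) ⟨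
      [ toℕ a + toℕ c ] +ₚ [ toℕ d ]          ≡⟨ []-+ (toℕ a + toℕ c) (toℕ d) ⟨
      [ toℕ a + toℕ c + toℕ d ]               ≡⟨ cong [_] (ℕ.+-assoc (toℕ a) (toℕ c) (toℕ d)) ⟩
      [ toℕ a + (toℕ c + toℕ d) ]             ≡⟨ []-+ (toℕ a) (toℕ c + toℕ d) ⟩
      [ toℕ a ] +ₚ [ toℕ c + toℕ d ]          ≡⟨ cong (_+ₚ (c +ₚ d)) ([]-toℕ a) ⟩
      a +ₚ (c +ₚ d)                           ∎

    inverseʳ : ∀ a → a +ₚ -ₚ a ≡ zero
    inverseʳ a = begin
      a +ₚ [ p ∸ toℕ a ]                      ≡⟨ cong (_+ₚ -ₚ a) ([]-toℕ a) ⟨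
      [ toℕ a ] +ₚ [ p ∸ toℕ a ]              ≡⟨ []-+ (toℕ a) (p ∸ toℕ a) ⟨
      [ toℕ a + (p ∸ toℕ a) ]                 ≡⟨ cong [_] (ℕ.m+[n∸m]≡n (ℕ.<⇒≤ (toℕ<n a))) ⟩
      [ p ]                                   ≡⟨ toℕ-injective (trans (toℕ-[] p) (n%n≡0 p)) ⟩
      zero                                    ∎

  +ₚ-abelianGroup : AbelianGroup 0ℓ 0ℓ
  +ₚ-abelianGroup = record { isAbelianGroup = +ₚ-isAbelianGroup }

  open import Algebra.Properties.CommutativeSemigroup (AbelianGroup.commutativeSemigroup +ₚ-abelianGroup)
    using (interchange)

  vadd-abelianGroup : ℕ → AbelianGroup 0ℓ 0ℓ
  vadd-abelianGroup m = record { isAbelianGroup = zipWith-isAbelianGroup {n = m} +ₚ-isAbelianGroup }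

  dot-+ : ∀ {n} (r u w : Vec (Fin p) n) → dot r (vadd u w) ≡ dot r u +ₚ dot r w
  dot-+ []      []      []      = refl
  dot-+ (a ∷ r) (c ∷ u) (d ∷ w) = begin
    [ toℕ a * toℕ (c +ₚ d) + S r (vadd u w) ]                   ≡⟨ []-+ (toℕ a * toℕ (c +ₚ d)) (S r (vadd u w)) ⟩
    [ toℕ a * toℕ [ toℕ c + toℕ d ] ] +ₚ dot r (vadd u w)       ≡⟨ cong₂ _+ₚ_ ([]-*-toℕ (toℕ a) (toℕ c + toℕ d)) (dot-+ r u w) ⟩
    [ toℕ a * (toℕ c + toℕ d) ] +ₚ (dot r u +ₚ dot r w)         ≡⟨ cong (_+ₚ (dot r u +ₚ dot r w)) a[c+d] ⟩
    ([ toℕ a * toℕ c ] +ₚ [ toℕ a * toℕ d ]) +ₚ (dot r u +ₚ dot r w)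
                                                                ≡⟨ interchange [ toℕ a * toℕ c ] [ toℕ a * toℕ d ] (dot r u) (dot r w) ⟩
    ([ toℕ a * toℕ c ] +ₚ dot r u) +ₚ ([ toℕ a * toℕ d ] +ₚ dot r w)
                                                                ≡⟨ cong₂ _+ₚ_ ([]-+ (toℕ a * toℕ c) (S r u)) ([]-+ (toℕ a * toℕ d) (S r w)) ⟨
    dot (a ∷ r) (c ∷ u) +ₚ dot (a ∷ r) (d ∷ w)                  ∎
    where
    open ≡-Reasoning
    S : ∀ {n} → Vec (Fin p) n → Vec (Fin p) n → ℕ
    S r u = Data.Vec.sum (zipWith (λ a c → toℕ a * toℕ c) r u)
    a[c+d] : [ toℕ a * (toℕ c + toℕ d) ] ≡ [ toℕ a * toℕ c ] +ₚ [ toℕ a * toℕ d ]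
    a[c+d] = trans (cong [_] (ℕ.*-distribˡ-+ (toℕ a) (toℕ c) (toℕ d))) ([]-+ (toℕ a * toℕ c) (toℕ a * toℕ d))

  map-dot-+ : ∀ {n k} (A : Vec (Vec (Fin p) n) k) u w →
           map (λ r → dot r (vadd u w)) A ≡ vadd (map (λ r → dot r u) A) (map (λ r → dot r w) A)
  map-dot-+ []      u w = refl
  map-dot-+ (r ∷ A) u w = cong₂ _∷_ (dot-+ r u w) (map-dot-+ A u w)

-- Designs with an affine group of automorphisms

module DesignFacts {v b k lam} {I : Fin v → Fin b → Bool} (D : Is2Design v b k lam I) where

  open Is2Design D

  block-through : ∀ {α α′} → α ≢ α′ → ∃ λ β → I α β ≡ true × I α′ β ≡ true
  block-through {α} {α′} α≢α′
    with β , αα′∈β ← 0<count⇒∃true (λ β → I α β ∧ I α′ β) (subst (0 <_) (sym (balanced α α′ α≢α′)) lam≥1)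
    = β , ∧-≡-true αα′∈β

  0<k : 0 < k
  0<k with α , α′ , α≢α′ ← distinct-pair two≤v
      with β , α∈β , _ ← block-through α≢α′
      = subst (0 <_) (blockSize β) (true⇒0<count (λ α → I α β) α∈β)

  point-on : ∀ β → ∃ λ α → I α β ≡ true
  point-on β = 0<count⇒∃true (λ α → I α β) (subst (0 <_) (sym (blockSize β)) 0<k)

  point-off : k < v → ∀ β → ∃ λ α → I α β ≡ false
  point-off k<v β = count<n⇒∃false (λ α → I α β) (subst (_< v) (sym (blockSize β)) k<v)

module AffineDesign {v b k lam} {I : Fin v → Fin b → Bool} {G : Auto v b → Set}
  (D : Is2Design v b k lam I) (k<v : k < v) (AG : IsAutGroup I G) (LP : LocallyPrimitive I G)
  {q m} (φ : Fin v ↔ Vec (Fin (suc q)) m) (PA : PrimitiveAffineVia φ G) where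

  open Is2Design D using (blockSize)
  open DesignFacts D
  open IsAutGroup AG renaming (hasId to G-id; closed to G-closed; inv to G-inv)
  open LocallyPrimitive LP
  open PrimitiveAffineVia PA
  open ℤₚ q
  open AbelianGroup (vadd-abelianGroup m)
    using (_⁻¹; assoc; identityˡ; identityʳ; inverseˡ; inverseʳ)
    renaming (Carrier to V; _∙_ to _+ᵥ_; ε to 0ᵥ)
  open import Algebra.Properties.AbelianGroup (vadd-abelianGroup m)
    using (\\-leftDividesˡ; //-rightDividesʳ; inverseˡ-unique; ⁻¹-injective)
  open import Algebra.Properties.CommutativeSemigroup (AbelianGroup.commutativeSemigroup (vadd-abelianGroup m))
    using (xy∙z≈xz∙y)

  _≟ᵥ_ : (u w : V) → Dec (u ≡ w)
  _≟ᵥ_ = ≡-dec Fin._≟_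

  φ→ : Fin v → V
  φ→ = Inverse.to φ

  φ← : V → Fin v
  φ← = Inverse.from φ

  φ→φ← : ∀ u → φ→ (φ← u) ≡ u
  φ→φ← = Inverse.strictlyInverseˡ φ

  φ→-injective : ∀ {α α′} → φ→ α ≡ φ→ α′ → α ≡ α′
  φ→-injective {α} {α′} e =
    trans (sym (Inverse.strictlyInverseʳ φ α)) (trans (cong φ← e) (Inverse.strictlyInverseʳ φ α′))

  G-invariant⇒⇔ : ∀ {n} {R : Rel (Fin n) 0ℓ} (act : Auto v b → Fin n → Fin n) →
                  (∀ g {x} → act (invA g) (act g x) ≡ x) →
                  (∀ {g} → G g → ∀ {x y} → R x y → R (act g x) (act g y)) →
                  ∀ {g} → G g → ∀ {x y} → R (act g x) (act g y) ⇔ R x y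
  G-invariant⇒⇔ {R = R} act cancel invariant gG =
    mk⇔ (λ r → subst₂ R (cancel _) (cancel _) (invariant (G-inv _ gG) r)) (invariant gG)

  pencil-trivial⊎universal : ∀ α {R : Rel (Fin b) 0ℓ} → Decidable R → IsEquivalence R →
                             (∀ {g} → G g → ∀ {x y} → R x y → R (blAct g x) (blAct g y)) →
                             TrivialOn (I α) R ⊎ UniversalOn (I α) R
  pencil-trivial⊎universal α R? R-equivalence invariant =
    primitive⇒trivial⊎universal (atPoint α) R? R-equivalence
      λ (gG , _) → G-invariant⇒⇔ blAct (λ g → Perm.inverseˡ (bl g)) invariant gG

  SamePoints : Rel (Fin b) 0ℓ
  SamePoints x y = ∀ α → I α x ≡ I α y

  SamePoints-isEquivalence : IsEquivalence SamePoints
  SamePoints-isEquivalence = record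
    { refl  = λ _ → refl
    ; sym   = λ e α → sym (e α)
    ; trans = λ e e′ α → trans (e α) (e′ α)
    }

  I-blAct : ∀ {g} → G g → ∀ α β → I α (blAct g β) ≡ I (pt g ⟨$⟩ˡ α) β
  I-blAct {g} gG α β = trans (cong (λ a → I a (blAct g β)) (sym (Perm.inverseʳ (pt g)))) (aut g gG _ β)

  SamePoints-invariant : ∀ {g} → G g → ∀ {x y} → SamePoints x y → SamePoints (blAct g x) (blAct g y)
  SamePoints-invariant gG {x} {y} e α = trans (I-blAct gG α x) (trans (e _) (sym (I-blAct gG α y)))

  another-block-through : ∀ {α x} → I α x ≡ true → ∃ λ γ → I α γ ≡ true × ¬ SamePoints x γ
  another-block-through {α} {x} α∈x
    with α₀ , α₀∉x ← point-off k<v x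
    with γ , α∈γ , α₀∈γ ← block-through {α} {α₀} (λ { refl → not-¬ α∈x α₀∉x })
    = γ , α∈γ , λ same → not-¬ α₀∈γ (trans (sym (same α₀)) α₀∉x)

  SamePoints⇒≡ : ∀ {x y} → SamePoints x y → x ≡ y
  SamePoints⇒≡ {x} {y} same
    with α , α∈x ← point-on x
    with pencil-trivial⊎universal α (λ x y → all? λ α → I α x Bool.≟ I α y)
           SamePoints-isEquivalence SamePoints-invariant
  ... | inj₁ trivial   = trivial x y α∈x (trans (sym (same α)) α∈x) same
  ... | inj₂ universal with γ , α∈γ , different ← another-block-through α∈x
    = ⊥-elim (different (universal x γ α∈x α∈γ))

  bl-determined : ∀ {g h} → G g → G h → (∀ α → ptAct g α ≡ ptAct h α) → ∀ β → blAct g β ≡ blAct h β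
  bl-determined {g} {h} gG hG g≗h β = SamePoints⇒≡ λ α → begin
    I α (blAct g β)                          ≡⟨ cong (λ a → I a (blAct g β)) α≡g[h⁻¹α] ⟩
    I (ptAct g (pt h ⟨$⟩ˡ α)) (blAct g β)    ≡⟨ aut g gG (pt h ⟨$⟩ˡ α) β ⟩
    I (pt h ⟨$⟩ˡ α) β                        ≡⟨ I-blAct hG α β ⟨
    I α (blAct h β)                          ∎
    where
    open ≡-Reasoning
    α≡g[h⁻¹α] : ∀ {α} → α ≡ ptAct g (pt h ⟨$⟩ˡ α)
    α≡g[h⁻¹α] = sym (trans (g≗h _) (Perm.inverseʳ (pt h)))

  linear : ∀ {g} → G g → V → V
  linear gG = matVec (proj₁ (affine _ gG))

  shift : ∀ {g} → G g → V
  shift gG = proj₁ (proj₂ (affine _ gG))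

  affine-pt : ∀ {g} (gG : G g) α → φ→ (ptAct g α) ≡ linear gG (φ→ α) +ᵥ shift gG
  affine-pt gG = proj₂ (proj₂ (proj₂ (affine _ gG)))

  affine-pt-+ : ∀ {g} (gG : G g) {α α′} c → φ→ α ≡ φ→ α′ +ᵥ c →
                φ→ (ptAct g α) ≡ φ→ (ptAct g α′) +ᵥ linear gG c
  affine-pt-+ {g} gG {α} {α′} c e = begin
    φ→ (ptAct g α)                                  ≡⟨ affine-pt gG α ⟩
    A (φ→ α) +ᵥ shift gG                            ≡⟨ cong (λ u → A u +ᵥ shift gG) e ⟩
    A (φ→ α′ +ᵥ c) +ᵥ shift gG                      ≡⟨ cong (_+ᵥ shift gG) (map-dot-+ (proj₁ (affine _ gG)) (φ→ α′) c) ⟩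
    A (φ→ α′) +ᵥ A c +ᵥ shift gG                    ≡⟨ xy∙z≈xz∙y (A (φ→ α′)) (A c) (shift gG) ⟩
    A (φ→ α′) +ᵥ shift gG +ᵥ A c                    ≡⟨ cong (_+ᵥ A c) (affine-pt gG α′) ⟨
    φ→ (ptAct g α′) +ᵥ A c                          ∎
    where
    open ≡-Reasoning
    A : V → V
    A = linear gG

  translation : V → Auto v b
  translation c = proj₁ (translations c)

  translation∈G : ∀ c → G (translation c)
  translation∈G c = proj₁ (proj₂ (translations c))

  translation-pt : ∀ c α → φ→ (ptAct (translation c) α) ≡ φ→ α +ᵥ c
  translation-pt c = proj₂ (proj₂ (translations c))

  T : V → Fin b → Fin b
  T c = blAct (translation c)

  T-unique : ∀ {g c} → G g → (∀ α → φ→ (ptAct g α) ≡ φ→ α +ᵥ c) → ∀ β → blAct g β ≡ T c β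
  T-unique {c = c} gG g-pt =
    bl-determined gG (translation∈G c) λ α → φ→-injective (trans (g-pt α) (sym (translation-pt c α)))

  T-identity : ∀ β → T 0ᵥ β ≡ β
  T-identity β = sym (T-unique G-id (λ α → sym (identityʳ (φ→ α))) β)

  T-+ : ∀ c d β → T d (T c β) ≡ T (c +ᵥ d) β
  T-+ c d = T-unique (G-closed _ _ (translation∈G c) (translation∈G d)) λ α →
    trans (translation-pt d _) (trans (cong (_+ᵥ d) (translation-pt c α)) (assoc (φ→ α) c d))

  T-conj : ∀ {h} (hG : G h) c β → blAct h (T c β) ≡ T (linear hG c) (blAct h β)
  T-conj hG c = bl-determined (G-closed _ _ (translation∈G c) hG) (G-closed _ _ hG (translation∈G _)) λ α →
    φ→-injective (trans (affine-pt-+ hG c (translation-pt c α)) (sym (translation-pt _ _)))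

  T-⁻¹ : ∀ {π : Permutation′ b} {c} → (∀ β → π ⟨$⟩ʳ β ≡ T c β) → ∀ β → π ⟨$⟩ˡ β ≡ T (c ⁻¹) β
  T-⁻¹ {π} {c} π≗T β = begin
    π ⟨$⟩ˡ β                         ≡⟨ cong (π ⟨$⟩ˡ_) T-cancel ⟨
    π ⟨$⟩ˡ T c (T (c ⁻¹) β)          ≡⟨ cong (π ⟨$⟩ˡ_) (π≗T _) ⟨
    π ⟨$⟩ˡ (π ⟨$⟩ʳ T (c ⁻¹) β)       ≡⟨ Perm.inverseˡ π ⟩
    T (c ⁻¹) β                       ∎
    where
    open ≡-Reasoning
    T-cancel : T c (T (c ⁻¹) β) ≡ β
    T-cancel = trans (T-+ (c ⁻¹) c β) (trans (cong (λ d → T d β) (inverseˡ c)) (T-identity β))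

  -- N-orbits on blocks

  _~_ : Rel (Fin b) 0ℓ
  x ~ y = ∃ λ c → T c x ≡ y

  _~?_ : Decidable _~_
  x ~? y = map′ (λ (a , e) → φ→ a , e) (λ (c , e) → φ← c , trans (cong (λ c → T c x) (φ→φ← c)) e)
                (any? λ a → T (φ→ a) x Fin.≟ y)

  ~-refl : ∀ {x} → x ~ x
  ~-refl = 0ᵥ , T-identity _

  ~-sym : ∀ {x y} → x ~ y → y ~ x
  ~-sym {x} (c , refl) =
    c ⁻¹ , trans (T-+ c (c ⁻¹) x) (trans (cong (λ d → T d x) (inverseʳ c)) (T-identity x))

  ~-trans : ∀ {x y z} → x ~ y → y ~ z → x ~ z
  ~-trans {x} (c , refl) (d , refl) = c +ᵥ d , sym (T-+ c d x)

  ~-isEquivalence : IsEquivalence _~_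
  ~-isEquivalence = record { refl = ~-refl ; sym = ~-sym ; trans = ~-trans }

  ~-invariant : ∀ {g} → G g → ∀ {x y} → x ~ y → blAct g x ~ blAct g y
  ~-invariant {g} gG {x} (c , e) = linear gG c , trans (sym (T-conj gG c x)) (cong (blAct g) e)

  N-Transitive : Set
  N-Transitive = ∀ x y → x ~ y

  into-pencil : Fin b → Fin v → Fin b
  into-pencil x α = T (φ→ (proj₁ (point-on x)) ⁻¹ +ᵥ φ→ α) x

  x~into-pencil : ∀ x α → x ~ into-pencil x α
  x~into-pencil x α = _ , refl

  into-pencil-∈ : ∀ x α → I α (into-pencil x α) ≡ true
  into-pencil-∈ x α = begin
    I α (T d x)                                   ≡⟨ cong (λ a → I a (T d x)) α₀↦α ⟨
    I (ptAct (translation d) α₀) (T d x)          ≡⟨ aut _ (translation∈G d) α₀ x ⟩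
    I α₀ x                                        ≡⟨ proj₂ (point-on x) ⟩
    true                                          ∎
    where
    open ≡-Reasoning
    α₀ : Fin v
    α₀ = proj₁ (point-on x)
    d : V
    d = φ→ α₀ ⁻¹ +ᵥ φ→ α
    α₀↦α : ptAct (translation d) α₀ ≡ α
    α₀↦α = φ→-injective (trans (translation-pt d α₀) (\\-leftDividesˡ (φ→ α₀) (φ→ α)))

  pencil-meets-orbit-once : ¬ N-Transitive → ∀ {α x y} → I α x ≡ true → I α y ≡ true → x ~ y → x ≡ y
  pencil-meets-orbit-once ¬N-transitive {α} {x} {y} α∈x α∈y x~y
    with pencil-trivial⊎universal α _~?_ ~-isEquivalence ~-invariant
  ... | inj₁ trivial   = trivial x y α∈x α∈y x~y
  ... | inj₂ universal = ⊥-elim (¬N-transitive λ x y →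
    ~-trans (x~into-pencil x α)
      (~-trans (universal _ _ (into-pencil-∈ x α) (into-pencil-∈ y α)) (~-sym (x~into-pencil y α))))

  _~ᵇ_ : Fin b → Fin b → Bool
  x ~ᵇ y = does (x ~? y)

  orbit∩pencil≡1 : ¬ N-Transitive → ∀ x α → count (λ y → x ~ᵇ y ∧ I α y) ≡ 1
  orbit∩pencil≡1 ¬N-transitive x α =
    count≡1 _ (cong₂ _∧_ (dec-true (x ~? _) (x~into-pencil x α)) (into-pencil-∈ x α)) λ y x~y∧α∈y →
      let x~y , α∈y = ∧-≡-true x~y∧α∈y in
      sym (pencil-meets-orbit-once ¬N-transitive (into-pencil-∈ x α) α∈y
             (~-trans (~-sym (x~into-pencil x α)) (does≡true⇒ (x ~? y) x~y)))

  pencil∩orbit≡1 : ¬ N-Transitive → ∀ α y → count (λ x → I α x ∧ x ~ᵇ y) ≡ 1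
  pencil∩orbit≡1 ¬N-transitive α y =
    count≡1 _ (cong₂ _∧_ (into-pencil-∈ y α) (dec-true (_ ~? y) (~-sym (x~into-pencil y α)))) λ x α∈x∧x~y →
      let α∈x , x~y = ∧-≡-true α∈x∧x~y in
      pencil-meets-orbit-once ¬N-transitive α∈x (into-pencil-∈ y α) (~-trans (does≡true⇒ (x ~? y) x~y) (x~into-pencil y α))

  orbit-size : Fin b → ℕ
  orbit-size x = count (x ~ᵇ_)

  orbit-size*k≡v : ¬ N-Transitive → ∀ x → orbit-size x * k ≡ v
  orbit-size*k≡v ¬N-transitive x =
    double-count (x ~ᵇ_) (λ y α → I α y) (λ y _ → blockSize y) (orbit∩pencil≡1 ¬N-transitive x)

  orbit-size*r≡b : ¬ N-Transitive → ∀ x α → orbit-size x * repl I α ≡ b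
  orbit-size*r≡b ¬N-transitive x α =
    trans (ℕ.*-comm (orbit-size x) _) (double-count (I α) _~ᵇ_ (λ y _ → same-size y) (pencil∩orbit≡1 ¬N-transitive α))
    where
    same-size : ∀ y → orbit-size y ≡ orbit-size x
    same-size y = ℕ.*-cancelʳ-≡ _ _ k {{>-nonZero 0<k}}
      (trans (orbit-size*k≡v ¬N-transitive y) (sym (orbit-size*k≡v ¬N-transitive x)))

  orbit-enumeration : ∀ β → OrbitSize (Socle φ G) β (orbit-size β)
  orbit-enumeration β = enumerate (β ~ᵇ_) , enumerate-injective (β ~ᵇ_) , reached , covered
    where
    reached : ∀ i → ∃ λ g → Socle φ G g × blAct g β ≡ enumerate (β ~ᵇ_) i
    reached i with c , e ← does≡true⇒ (β ~? _) (enumerate-true (β ~ᵇ_) i)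
      = translation c , (translation∈G c , c , translation-pt c) , e
    covered : ∀ β′ → (∃ λ g → Socle φ G g × blAct g β ≡ β′) → ∃ λ i → enumerate (β ~ᵇ_) i ≡ β′
    covered β′ (g , (gG , c , g-pt) , e) =
      enumerate-surjective (β ~ᵇ_) (dec-true (β ~? β′) (c , trans (sym (T-unique gG g-pt β)) e))

  -- If N is transitive on blocks, G^B is quasiprimitive

  data Span (w : V) : V → Set where
    base  : Span w w
    add   : ∀ {u u′} → Span w u → Span w u′ → Span w (u +ᵥ u′)
    neg   : ∀ {u} → Span w u → Span w (u ⁻¹)
    image : ∀ {g u} (gG : G g) → Span w u → Span w (linear gG u)

  Irreducible : Set
  Irreducible = ∀ w → w ≢ 0ᵥ → ∀ u → Span w u

  DifferIn : V → Rel (Fin v) 0ℓ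
  DifferIn w x y = ∃ λ c → Span w c × φ→ x ≡ φ→ y +ᵥ c

  DifferIn-isEquivalence : ∀ w → IsEquivalence (DifferIn w)
  DifferIn-isEquivalence w = record
    { refl  = 0ᵥ , subst (Span w) (inverseʳ w) (add base (neg base)) , sym (identityʳ _)
    ; sym   = λ { {x} {y} (c , s , e) →
                c ⁻¹ , neg s , sym (trans (cong (_+ᵥ c ⁻¹) e) (//-rightDividesʳ c (φ→ y))) }
    ; trans = λ { {x} {y} {z} (c , s , e) (d , s′ , e′) →
                d +ᵥ c , add s′ s , trans e (trans (cong (_+ᵥ c) e′) (assoc (φ→ z) d c)) }
    }

  DifferIn-invariant : ∀ w {g} → G g → ∀ {x y} → DifferIn w x y → DifferIn w (ptAct g x) (ptAct g y)
  DifferIn-invariant w gG (c , s , e) = linear gG c , image gG s , affine-pt-+ gG c e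

  DifferIn-origin : ∀ w u → DifferIn w (φ← u) (φ← 0ᵥ) ⇔ Span w u
  DifferIn-origin w u = mk⇔ (λ (c , s , e) → subst (Span w) (c≡u e) s)
                            (λ s → u , s , trans (φ→φ← u) (sym (origin+ u)))
    where
    origin+ : ∀ c → φ→ (φ← 0ᵥ) +ᵥ c ≡ c
    origin+ c = trans (cong (_+ᵥ c) (φ→φ← 0ᵥ)) (identityˡ c)
    c≡u : ∀ {c} → φ→ (φ← u) ≡ φ→ (φ← 0ᵥ) +ᵥ c → c ≡ u
    c≡u {c} e = trans (sym (origin+ c)) (trans (sym e) (φ→φ← u))

  -- The classes of DifferIn w are the cosets of Span w: a G-invariant partition of the points,
  -- which primitivity forces to be trivial (so w = 0) or universal.
  irreducible : (∀ w → Decidable (DifferIn w)) → Irreducible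
  irreducible DifferIn? w w≢0 u
    with primitive⇒trivial⊎universal isPrimitive (DifferIn? w) (DifferIn-isEquivalence w)
           (G-invariant⇒⇔ ptAct (λ g → Perm.inverseˡ (pt g)) (DifferIn-invariant w))
  ... | inj₁ trivial   = ⊥-elim (w≢0 (begin
    w                ≡⟨ φ→φ← w ⟨
    φ→ (φ← w)        ≡⟨ cong φ→ (trivial (φ← w) (φ← 0ᵥ) refl refl (Equivalence.from (DifferIn-origin w w) base)) ⟩
    φ→ (φ← 0ᵥ)       ≡⟨ φ→φ← 0ᵥ ⟩
    0ᵥ               ∎))
    where open ≡-Reasoning
  ... | inj₂ universal = Equivalence.to (DifferIn-origin w u) (universal (φ← u) (φ← 0ᵥ) refl refl)

  -- Span w is not decidable constructively, but Irreducible is only used to reach a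
  -- contradiction, so having it under double negation suffices.
  ¬¬-irreducible : ¬ ¬ Irreducible
  ¬¬-irreducible = ¬¬-map (irreducible ∘ on-vectors) (¬¬-∀ λ a → ¬¬-∀ λ x → ¬¬-∀ λ y → ¬¬-excluded-middle)
    where
    on-vectors : (∀ a → Decidable (DifferIn (φ→ a))) → ∀ w → Decidable (DifferIn w)
    on-vectors DifferIn? w = subst (λ w → Decidable (DifferIn w)) (φ→φ← w) (DifferIn? (φ← w))

  module _ {M : Permutation′ b → Set} (M-normal : IsNontrivNormalSubgroupOfGB G M) where

    open IsNontrivNormalSubgroupOfGB M-normal renaming (closed to M-closed; inv to M-inv)

    T∈M : V → Set
    T∈M c = ∃ λ τ → M τ × ∀ β → τ ⟨$⟩ʳ β ≡ T c β

    T∈M-span : ∀ {w u} → T∈M w → Span w u → T∈M u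
    T∈M-span w∈M base = w∈M
    T∈M-span w∈M (add {u} {u′} s s′)
      with σ , σ∈M , σ≗T ← T∈M-span w∈M s
      with τ , τ∈M , τ≗T ← T∈M-span w∈M s′
      = σ ∘ₚ τ , M-closed σ τ σ∈M τ∈M , λ β → trans (τ≗T _) (trans (cong (T u′) (σ≗T β)) (T-+ u u′ β))
    T∈M-span w∈M (neg s) with τ , τ∈M , τ≗T ← T∈M-span w∈M s
      = flip τ , M-inv τ τ∈M , T-⁻¹ {τ} τ≗T
    T∈M-span w∈M (image {g} {u} gG s) with τ , τ∈M , τ≗T ← T∈M-span w∈M s
      = flip (bl g) ∘ₚ (τ ∘ₚ bl g) , normal g τ gG τ∈M , λ β →
          trans (cong (blAct g) (τ≗T _)) (trans (T-conj gG u _) (cong (T (linear gG u)) (Perm.inverseʳ (bl g))))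

    T∈M-commutator : ∀ {τ g} → M τ → (gG : G g) → (∀ β → blAct g β ≡ τ ⟨$⟩ʳ β) → ∀ u → T∈M (u ⁻¹ +ᵥ linear gG u)
    T∈M-commutator {τ} {g} τ∈M gG g≗τ u = ρ , ρ∈M , λ β → begin
      τ ⟨$⟩ʳ T u (τ ⟨$⟩ˡ (t ⟨$⟩ˡ β))         ≡⟨ g≗τ _ ⟨
      blAct g (T u (τ ⟨$⟩ˡ (t ⟨$⟩ˡ β)))      ≡⟨ T-conj gG u _ ⟩
      T (A u) (blAct g (τ ⟨$⟩ˡ (t ⟨$⟩ˡ β)))  ≡⟨ cong (T (A u)) (trans (g≗τ _) (Perm.inverseʳ τ)) ⟩
      T (A u) (t ⟨$⟩ˡ β)                    ≡⟨ cong (T (A u)) (T-⁻¹ {t} (λ _ → refl) β) ⟩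
      T (A u) (T (u ⁻¹) β)                  ≡⟨ T-+ (u ⁻¹) (A u) β ⟩
      T (u ⁻¹ +ᵥ A u) β                     ∎
      where
      open ≡-Reasoning
      A : V → V
      A = linear gG
      t : Permutation′ b
      t = bl (translation u)
      -- as a map, ρ = τ ∘ t ∘ τ⁻¹ ∘ t⁻¹ (_∘ₚ_ composes left to right)
      ρ : Permutation′ b
      ρ = (flip t ∘ₚ (flip τ ∘ₚ t)) ∘ₚ τ
      ρ∈M : M ρ
      ρ∈M = M-closed _ τ (normal (translation u) (flip τ) (translation∈G u) (M-inv τ τ∈M)) τ∈M

    -- Either τ comes from a translation, or its linear part A moves some u and the
    -- commutator of τ with t_u is the translation by A u − u.
    nonzero-T∈M : ∃ λ w → w ≢ 0ᵥ × T∈M w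
    nonzero-T∈M
      with τ , τ∈M , β , τβ≢β ← nontrivial
      with g , gG , g≗τ ← sub τ τ∈M
      with all? (λ a → linear gG (φ→ a) ≟ᵥ φ→ a)
    ... | yes fixed = shift gG , shift≢0 , τ , τ∈M , τ≗T
      where
      τ≗T : ∀ β → τ ⟨$⟩ʳ β ≡ T (shift gG) β
      τ≗T β = trans (sym (g≗τ β)) (T-unique gG (λ α → trans (affine-pt gG α) (cong (_+ᵥ shift gG) (fixed α))) β)
      shift≢0 : shift gG ≢ 0ᵥ
      shift≢0 s≡0 = τβ≢β (trans (τ≗T β) (trans (cong (λ c → T c β) s≡0) (T-identity β)))
    ... | no ¬fixed with a , moved ← ¬∀⟶∃¬ v _ (λ a → linear gG (φ→ a) ≟ᵥ φ→ a) ¬fixed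
      = φ→ a ⁻¹ +ᵥ linear gG (φ→ a)
      , (λ e → moved (sym (⁻¹-injective (inverseˡ-unique _ _ e))))
      , T∈M-commutator τ∈M gG g≗τ (φ→ a)

  quasiprimitive : N-Transitive → Irreducible → QuasiprimitiveOnBlocks G
  quasiprimitive N-transitive irreducible = record
    { transitive       = λ x y _ _ → let c , e = N-transitive x y in translation c , translation∈G c , e
    ; normalTransitive = λ M M-normal x y _ _ →
        let w , w≢0 , w∈M = nonzero-T∈M M-normal
            c , e         = N-transitive x y
            τ , τ∈M , τ≗T = T∈M-span M-normal w∈M (irreducible w w≢0 c)
        in  τ , τ∈M , trans (τ≗T x) e
    }

  N-intransitive : ¬ QuasiprimitiveOnBlocks G → ¬ N-Transitive
  N-intransitive ¬quasiprimitive N-transitive = ¬¬-irreducible (¬quasiprimitive ∘ quasiprimitive N-transitive)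

lemma7p1 : ∀ (v b k lam : ℕ) (I : Fin v → Fin b → Bool) (G : Auto v b → Set) →
    Is2Design v b k lam I → k < v →
    IsAutGroup I G → LocallyPrimitive I G →
    ∀ (q m : ℕ) (φ : Fin v ↔ Vec (Fin (suc q)) m) →
    PrimitiveAffineVia φ G →
    ¬ QuasiprimitiveOnBlocks G →
    ∀ (β : Fin b) → Σ ℕ λ s → OrbitSize (Socle φ G) β s ×
      (s * k ≡ v) × (∀ (α : Fin v) → s * repl I α ≡ b)
lemma7p1 v b k lam I G D k<v AG LP q m φ PA ¬quasiprimitive β =
  orbit-size β , orbit-enumeration β , orbit-size*k≡v ¬N-transitive β , orbit-size*r≡b ¬N-transitive β
  where
  open AffineDesign D k<v AG LP φ PA
  ¬N-transitive : ¬ N-Transitive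
  ¬N-transitive = N-intransitive ¬quasiprimitive
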